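{- Let $n\ge1$, let $m=(m_0,\dots,m_n)$ be a sequence of non-negative integers, and assign weights to the edges of $\mathcal{G}^s_n$ as follows: the vertical edges, from left to right, have weights $a_0,a_1,\dots,a_n$; the top horizontal edges, from left to right, have weights $b_1,\dots,b_n$; the bottom horizontal edges, from left to right, have weights $c_1,\dots,c_n$. Define \[ X := U_{m_0}(a_0)\prod_{k=1}^n T_{m_{k-1},m_k}(b_kc_k)\,U_{m_k}(a_k), \] the product taken in left-to-right order of increasing $k$. Then for all $1\le i\le m_0+1$, $1\le j\le m_n+1$, the entry $X_{ij}$ equals $\sum_{\omega}\mathrm{wt}(\omega)$, summed over all $\omega\in\Omega^{ij}_{\mathbf{n}_m}(\mathcal{G}^s_n)$, where $\mathrm{wt}(\omega)$ is the product over all edges $e$ of (weight of $e$)$^{\omega(e)}$.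
   Context: Mixed dimer covers: for a finite graph $\mathcal{G}=(V,E)$ and $\mathbf{n}\colon V\to\mathbb{N}$, an $\mathbf{n}$-dimer cover is a function $\omega\colon E\to\mathbb{N}$ such that $\sum_{e\ni v}\omega(e)=\mathbf{n}(v)$ for every vertex $v$; the set of these is $\Omega_{\mathbf{n}}(\mathcal{G})$. $\mathcal{G}^s_n$ is the $2\times(n+1)$ grid graph with bottom vertices $v_{1,0},\dots,v_{1,n}$, top vertices $v_{2,0},\dots,v_{2,n}$, vertical edges $v_{1,k}v_{2,k}$ and horizontal edges $v_{r,k-1}v_{r,k}$. For $x=(x_0,\dots,x_n)$, $\mathbf{n}_x(v_{1,k})=\mathbf{n}_x(v_{2,k})=x_k$. $\Omega^{ij}_{\mathbf{n}_m}(\mathcal{G}^s_n):=\Omega_{\mathbf{n}_{m'}}(\mathcal{G}^s_n)$ with $m'=(m_0+1-i,m_1,\dots,m_{n-1},m_n+1-j)$. For a parameter $t$ and integer $N\ge0$, $U_N(t)$ is the $(N+1)\times(N+1)$ matrix whose $(i,j)$-entry is $t^{N+2-i-j}$ if $i+j\le N+2$ and $0$ otherwise. For integers $a,b\ge0$, $T_{a,b}(t)$ is the $(a+1)\times(b+1)$ matrix whose $(i,i)$-entry is $t^{i-1}$ (for $1\le i\le \min(a,b)+1$) and whose other entries are $0$. -}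

module Defs where

open import Level using (Level)
open import Algebra.Bundles using (CommutativeSemiring)
open import Data.Nat as ℕ using (ℕ; zero; suc; _∸_; _≤ᵇ_; _≡ᵇ_)
open import Data.Fin as Fin using (Fin; toℕ; fromℕ; inject₁)
open import Data.Fin.Properties using () renaming (_≟_ to _≟ᶠ_)
open import Data.Bool using (Bool; true; false; if_then_else_)
open import Data.Product using (_×_; _,_; proj₁; proj₂)
open import Data.Product.Properties using (≡-dec)
open import Data.Sum using (_⊎_)
open import Data.List using (List; []; _∷_; map; _++_; concatMap; filter; foldr; allFin; upTo; cartesianProduct)
open import Data.List.Relation.Unary.All using (All; all?)
import Data.Vec.Functional as VF
open import Relation.Binary.PropositionalEquality using (_≡_)
open import Relation.Nullary using (Dec)
open import Relation.Nullary.Decidable using (_⊎-dec_)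

-- The graph G^s_n : 2 × (n+1) grid.
-- Vertices: (row , column); row 0 = bottom row (v_{1,k}), row 1 = top row (v_{2,k}).

Vertex : ℕ → Set
Vertex n = Fin 2 × Fin (suc n)

-- Edges:
--   vert k  (k = 0..n)   : v_{1,k} — v_{2,k}
--   top  k  (k = 0..n-1) : v_{2,k} — v_{2,k+1}   (the paper's top edge number k+1)
--   bot  k  (k = 0..n-1) : v_{1,k} — v_{1,k+1}   (the paper's bottom edge number k+1)
data Edge (n : ℕ) : Set where
  vert : Fin (suc n) → Edge n
  top  : Fin n → Edge n
  bot  : Fin n → Edge n

ends : ∀ {n} → Edge n → Vertex n × Vertex n
ends (vert k) = (Fin.zero , k) , (Fin.suc Fin.zero , k)
ends (top k)  = (Fin.suc Fin.zero , inject₁ k) , (Fin.suc Fin.zero , Fin.suc k)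
ends (bot k)  = (Fin.zero , inject₁ k) , (Fin.zero , Fin.suc k)

allEdges : ∀ n → List (Edge n)
allEdges n = map vert (allFin (suc n)) ++ map top (allFin n) ++ map bot (allFin n)

allVertices : ∀ n → List (Vertex n)
allVertices n = cartesianProduct (allFin 2) (allFin (suc n))

_≟ᵛ_ : ∀ {n} (u v : Vertex n) → Dec (u ≡ v)
_≟ᵛ_ = ≡-dec _≟ᶠ_ _≟ᶠ_

incident? : ∀ {n} (v : Vertex n) (e : Edge n) →
            Dec (v ≡ proj₁ (ends e) ⊎ v ≡ proj₂ (ends e))
incident? v e = (v ≟ᵛ proj₁ (ends e)) ⊎-dec (v ≟ᵛ proj₂ (ends e))

sumℕ : List ℕ → ℕ
sumℕ = foldr ℕ._+_ 0

deg : ∀ {n} → (Edge n → ℕ) → Vertex n → ℕ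
deg {n} ω v = sumℕ (map ω (filter (incident? v) (allEdges n)))

nx : ∀ {n} → (Fin (suc n) → ℕ) → Vertex n → ℕ
nx x (_ , k) = x k

IsCover : ∀ {n} → (Vertex n → ℕ) → (Edge n → ℕ) → Set
IsCover {n} 𝐧 ω = All (λ v → deg ω v ≡ 𝐧 v) (allVertices n)

isCover? : ∀ {n} (𝐧 : Vertex n → ℕ) (ω : Edge n → ℕ) → Dec (IsCover 𝐧 ω)
isCover? {n} 𝐧 ω = all? (λ v → deg ω v ℕ.≟ 𝐧 v) (allVertices n)

boundedFuns : (k B : ℕ) → List (Fin k → ℕ)
boundedFuns zero    B = (λ ()) ∷ []
boundedFuns (suc k) B =
  concatMap (λ v → map (λ f → v VF.∷ f) (boundedFuns k B)) (upTo (suc B))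

mkω : ∀ {n} → (Fin (suc n) → ℕ) → (Fin n → ℕ) → (Fin n → ℕ) → Edge n → ℕ
mkω f g h (vert k) = f k
mkω f g h (top k)  = g k
mkω f g h (bot k)  = h k

boundedω : ∀ n (B : ℕ) → List (Edge n → ℕ)
boundedω n B =
  concatMap (λ f → concatMap (λ g → map (λ h → mkω f g h) (boundedFuns n B))
                             (boundedFuns n B))
            (boundedFuns (suc n) B)

-- For an n_x-dimer cover, ω(e) ≤ x_k ≤ Σ_k x_k for any endpoint column k of e,
-- so every cover occurs (exactly once) among the bounded functions.
Ω : ∀ n → (Fin (suc n) → ℕ) → List (Edge n → ℕ)
Ω n x = filter (isCover? (nx x)) (boundedω n (sumℕ (map x (allFin (suc n)))))

-- m' = (m_0 + 1 - i, m_1, …, m_{n-1}, m_n + 1 - j), with i = toℕ i' + 1, j = toℕ j' + 1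
shiftEnds : ∀ n (m : Fin (suc n) → ℕ) → Fin (suc (m Fin.zero)) → Fin (suc (m (fromℕ n))) →
            Fin (suc n) → ℕ
shiftEnds n m i j k =
  if toℕ k ≡ᵇ 0 then m Fin.zero ∸ toℕ i
  else if toℕ k ≡ᵇ n then m (fromℕ n) ∸ toℕ j
  else m k

module _ {c ℓ : Level} (R : CommutativeSemiring c ℓ) where
  open CommutativeSemiring R renaming (Carrier to C)

  pow : C → ℕ → C
  pow x zero    = 1#
  pow x (suc k) = x * pow x k

  sumL : List C → C
  sumL = foldr _+_ 0#

  prodL : List C → C
  prodL = foldr _*_ 1#

  sumFin : (k : ℕ) → (Fin k → C) → C
  sumFin k f = sumL (map f (allFin k))

  Mat : ℕ → ℕ → Set c
  Mat r s = Fin r → Fin s → C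

  _⊗_ : ∀ {r s u} → Mat r s → Mat s u → Mat r u
  _⊗_ {s = s} A B i k = sumFin s (λ j → A i j * B j k)

  U : (N : ℕ) → C → Mat (suc N) (suc N)
  U N t i j = if (toℕ i ℕ.+ toℕ j) ≤ᵇ N then pow t (N ∸ (toℕ i ℕ.+ toℕ j)) else 0#

  T : (a b : ℕ) → C → Mat (suc a) (suc b)
  T a b t i j = if toℕ i ≡ᵇ toℕ j then pow t (toℕ i) else 0#

  -- X = U_{m_0}(a_0) ∏_{k=1}^n T_{m_{k-1},m_k}(b_k c_k) U_{m_k}(a_k)
  -- (here a : Fin (n+1), b c : Fin n with b 0 = b_1 etc.)
  Xmat : ∀ n (m : Fin (suc n) → ℕ) (a : Fin (suc n) → C) (b c : Fin n → C) →
         Mat (suc (m Fin.zero)) (suc (m (fromℕ n)))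
  Xmat zero    m a b c = U (m Fin.zero) (a Fin.zero)
  Xmat (suc n) m a b c =
    (U (m Fin.zero) (a Fin.zero) ⊗ T (m Fin.zero) (m (Fin.suc Fin.zero)) (b Fin.zero * c Fin.zero))
      ⊗ Xmat n (λ k → m (Fin.suc k)) (λ k → a (Fin.suc k)) (λ k → b (Fin.suc k)) (λ k → c (Fin.suc k))

  edgeWt : ∀ {n} (a : Fin (suc n) → C) (b c : Fin n → C) → Edge n → C
  edgeWt a b c (vert k) = a k
  edgeWt a b c (top k)  = b k
  edgeWt a b c (bot k)  = c k

  wt : ∀ {n} (a : Fin (suc n) → C) (b c : Fin n → C) → (Edge n → ℕ) → C
  wt {n} a b c ω = prodL (map (λ e → pow (edgeWt a b c e) (ω e)) (allEdges n))

-- Since T is diagonal, expanding the product writes X_ij as a sum over intermediate indices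
-- l_1, …, l_n (with l_k ≤ m_k) of ∏_{k=0}^{n} U_{m_k}(a_k)[l_k, l_{k+1}] · ∏_{k=1}^{n} (b_k c_k)^{l_k},
-- where l_0 = i, l_{n+1} = j and U_N(t)[p, q] = t^{N-p-q} (or 0 when p + q > N).
-- In a cover, let g_k and h_k be the multiplicities of the k-th top and bottom horizontal edges
-- (g_0 = g_{n+1} = h_0 = h_{n+1} = 0). At column k, the degree conditions at the two vertices make the
-- vertical multiplicity both x_k - (g_k + g_{k+1}) and x_k - (h_k + h_{k+1}). Reading these equations
-- from left to right forces h = g. So covers correspond to sequences g with g_k + g_{k+1} ≤ x_k, and
-- such a cover has weight ∏_k a_k^{x_k - g_k - g_{k+1}} · ∏_k (b_k c_k)^{g_k}. For x = m′, that is
-- x_0 = m_0 - i and x_n = m_n - j with indices counted from 0, and l = g, this is exactly a term of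
-- the expanded product.
{-# OPTIONS --safe #-}
module Submission where

open import Defs
open import Level using (Level)
open import Algebra.Bundles using (CommutativeSemiring)
open import Data.Nat using (ℕ; suc; _≤_)
open import Data.Fin using (Fin; zero; fromℕ)
open import Data.List using (map)

open import Algebra.Bundles using (Monoid)
import Algebra.Properties.CommutativeMonoid.Sum as CommutativeMonoidSum
import Algebra.Properties.Monoid.Sum as MonoidSum
open import Data.Bool using (Bool; true; false; if_then_else_; _∧_; _∨_)
open import Data.Bool.Properties using (∨-identityʳ)
open import Data.Empty using (⊥-elim)
open import Data.Fin as Fin using (toℕ; inject₁)
open import Data.Fin.Properties using (_≟_; all?; ∀-cons-⇔; toℕ-fromℕ; toℕ-inject₁; toℕ<n; toℕ≤pred[n])
open import Data.Fin.Relation.Unary.Top using (view; ‵fromℕ; ‵inject₁)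
open import Data.List using (List; []; _∷_; _++_; concatMap; filter; tabulate; applyUpTo; upTo; allFin; lookup; length)
import Data.List.Properties as List
import Data.List.Relation.Unary.All as All
import Data.List.Relation.Unary.All.Properties as All
open import Data.Nat as ℕ using (_+_; _∸_; _<_; _≡ᵇ_; z≤n; s≤s)
import Data.Nat.Properties as ℕ
open import Data.Product using (_×_; _,_)
open import Data.Sum using (_⊎_)
open import Data.Vec.Functional as Vec using (tail)
open import Function using (_∘_; id; _⇔_; mk⇔; Equivalence)
open import Relation.Nullary using (Dec; does; yes; no)
open import Relation.Nullary.Decidable using (_⊎-dec_; _×-dec_; does-⇔; dec-true; dec-false)
open import Relation.Unary using (Pred; Decidable)
open import Relation.Binary.PropositionalEquality as ≡ using (_≡_; cong; cong₂)

module ListFold {a ℓ} (M : Monoid a ℓ) where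
  open Monoid M
  open MonoidSum M using (sum)
  open import Relation.Binary.Reasoning.Setoid setoid

  fold : List Carrier → Carrier
  fold = Data.List.foldr _∙_ ε

  fold-++ : ∀ {A : Set} (F : A → Carrier) xs ys →
            fold (map F (xs ++ ys)) ≈ fold (map F xs) ∙ fold (map F ys)
  fold-++ F []       ys = sym (identityˡ _)
  fold-++ F (x ∷ xs) ys = trans (∙-congˡ (fold-++ F xs ys)) (sym (assoc _ _ _))

  fold-concatMap : ∀ {A B : Set} (F : B → Carrier) (G : A → List B) xs →
                   fold (map F (concatMap G xs)) ≈ fold (map (λ x → fold (map F (G x))) xs)
  fold-concatMap F G []       = refl
  fold-concatMap F G (x ∷ xs) = trans (fold-++ F (G x) _) (∙-congˡ (fold-concatMap F G xs))

  fold-filter : ∀ {A : Set} {p} {P : Pred A p} (P? : Decidable P) (F : A → Carrier) xs →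
                fold (map F (filter P? xs)) ≈ fold (map (λ x → if does (P? x) then F x else ε) xs)
  fold-filter P? F []       = refl
  fold-filter P? F (x ∷ xs) with does (P? x)
  ... | true  = ∙-congˡ (fold-filter P? F xs)
  ... | false = trans (fold-filter P? F xs) (sym (identityˡ _))

  fold-lookup : ∀ {A : Set} (F : A → Carrier) xs → fold (map F xs) ≡ sum (F ∘ lookup xs)
  fold-lookup F []       = ≡.refl
  fold-lookup F (x ∷ xs) = cong (F x ∙_) (fold-lookup F xs)

  fold-tabulate : ∀ {A : Set} {k} (F : A → Carrier) (f : Fin k → A) → fold (map F (tabulate f)) ≡ sum (F ∘ f)
  fold-tabulate {k = ℕ.zero} F f = ≡.refl
  fold-tabulate {k = suc k}  F f = cong (F (f zero) ∙_) (fold-tabulate F (f ∘ Fin.suc))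

  fold-applyUpTo : ∀ k (F : ℕ → Carrier) (f : ℕ → ℕ) →
                   fold (map F (applyUpTo f k)) ≡ sum {k} (λ v → F (f (toℕ v)))
  fold-applyUpTo ℕ.zero  F f = ≡.refl
  fold-applyUpTo (suc k) F f = cong (F (f 0) ∙_) (fold-applyUpTo k F (f ∘ suc))

  fold-allEdges : ∀ n (F : Edge n → Carrier) →
                  fold (map F (allEdges n)) ≈ sum (F ∘ vert) ∙ (sum (F ∘ top) ∙ sum (F ∘ bot))
  fold-allEdges n F = begin
    fold (map F (map vert (allFin (suc n)) ++ map top (allFin n) ++ map bot (allFin n)))
      ≈⟨ fold-++ F (map vert (allFin (suc n))) _ ⟩
    fold (map F (map vert (allFin (suc n)))) ∙ fold (map F (map top (allFin n) ++ map bot (allFin n)))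
      ≈⟨ ∙-cong (reflexive (fold-map-allFin vert)) (fold-++ F (map top (allFin n)) _) ⟩
    sum (F ∘ vert) ∙ (fold (map F (map top (allFin n))) ∙ fold (map F (map bot (allFin n))))
      ≡⟨ cong₂ (λ s t → sum (F ∘ vert) ∙ (s ∙ t)) (fold-map-allFin top) (fold-map-allFin bot) ⟩
    sum (F ∘ vert) ∙ (sum (F ∘ top) ∙ sum (F ∘ bot)) ∎
    where
    fold-map-allFin : ∀ {k} (e : Fin k → Edge n) → fold (map F (map e (allFin k))) ≡ sum (F ∘ e)
    fold-map-allFin e = ≡.trans (cong (fold ∘ map F) (List.map-tabulate id e)) (fold-tabulate F e)

module ℕ-Sum = CommutativeMonoidSum ℕ.+-0-commutativeMonoid
module ℕ-Fold = ListFold ℕ.+-0-monoid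
open ℕ-Sum using () renaming (sum to ∑ℕ)

≤-∑ℕ : ∀ {n} (f : Fin n → ℕ) k → f k ≤ ∑ℕ f
≤-∑ℕ f zero        = ℕ.m≤m+n (f zero) _
≤-∑ℕ f (Fin.suc k) = ℕ.≤-trans (≤-∑ℕ (tail f) k) (ℕ.m≤n+m _ (f zero))

≤-sumℕ : ∀ {n} (x : Fin n → ℕ) k → x k ≤ sumℕ (map x (allFin n))
≤-sumℕ x k = ≡.subst (x k ≤_) (≡.sym (ℕ-Fold.fold-tabulate x id)) (≤-∑ℕ x k)

-- hdeg p q g k is the number of horizontal dimers at column k of a row whose edges carry g, with
-- extra edges of multiplicity p and q attached at the two ends (they carry the matrix indices i, j).
hdeg : ∀ {n} → ℕ → ℕ → (Fin n → ℕ) → Fin (suc n) → ℕ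
hdeg {ℕ.zero} p q g zero        = p + q
hdeg {suc n}  p q g zero        = p + g zero
hdeg {suc n}  p q g (Fin.suc k) = hdeg (g zero) q (tail g) k

hdeg-left : ∀ {n} p q (g : Fin n → ℕ) k → hdeg p q g k ≡ (if does (k ≟ zero) then p else 0) + hdeg 0 q g k
hdeg-left {ℕ.zero} p q g zero        = ≡.refl
hdeg-left {suc n}  p q g zero        = ≡.refl
hdeg-left {suc n}  p q g (Fin.suc k) = ≡.refl

hdeg-last : ∀ {n} p q (g : Fin n → ℕ) → hdeg p q g (fromℕ n) ≡ q + hdeg p 0 g (fromℕ n)
hdeg-last {ℕ.zero} p q g = ≡.trans (ℕ.+-comm p q) (cong (q +_) (≡.sym (ℕ.+-identityʳ p)))
hdeg-last {suc n}  p q g = hdeg-last (g zero) q (tail g)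

hdeg-inject₁ : ∀ {n} p q q′ (g : Fin n → ℕ) k → hdeg p q g (inject₁ k) ≡ hdeg p q′ g (inject₁ k)
hdeg-inject₁ {suc n} p q q′ g zero        = ≡.refl
hdeg-inject₁ {suc n} p q q′ g (Fin.suc k) = hdeg-inject₁ (g zero) q q′ (tail g) k

hdeg-cong : ∀ {n} p q {g h : Fin n → ℕ} → (∀ k → g k ≡ h k) → ∀ k → hdeg p q g k ≡ hdeg p q h k
hdeg-cong {ℕ.zero} p q g≗h zero                = ≡.refl
hdeg-cong {suc n}  p q g≗h zero                = cong (p +_) (g≗h zero)
hdeg-cong {suc n}  p q {g} {h} g≗h (Fin.suc k) =
  ≡.trans (hdeg-cong (g zero) q (g≗h ∘ Fin.suc) k) (cong (λ r → hdeg r q (tail h) k) (g≗h zero))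

hdeg-injective : ∀ {n} p q {g h : Fin n → ℕ} → (∀ k → hdeg p q g k ≡ hdeg p q h k) → ∀ k → g k ≡ h k
hdeg-injective {suc n} p q e zero                = ℕ.+-cancelˡ-≡ p _ _ (e zero)
hdeg-injective {suc n} p q {g} {h} e (Fin.suc k) = hdeg-injective (g zero) q e′ k
  where
  e′ : ∀ k → hdeg (g zero) q (tail g) k ≡ hdeg (g zero) q (tail h) k
  e′ k = ≡.trans (e (Fin.suc k)) (cong (λ r → hdeg r q (tail h) k) (≡.sym (hdeg-injective p q e zero)))

≤-hdeg-zero : ∀ {n} p q (g : Fin n → ℕ) → p ≤ hdeg p q g zero
≤-hdeg-zero {ℕ.zero} p q g = ℕ.m≤m+n p q
≤-hdeg-zero {suc n}  p q g = ℕ.m≤m+n p (g zero)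

≤-hdeg-suc : ∀ {n} p q (g : Fin n → ℕ) k → g k ≤ hdeg p q g (Fin.suc k)
≤-hdeg-suc {suc n} p q g zero        = ≤-hdeg-zero (g zero) q (tail g)
≤-hdeg-suc {suc n} p q g (Fin.suc k) = ≤-hdeg-suc (g zero) q (tail g) k

touches? : ∀ {n} (k : Fin (suc n)) (k′ : Fin n) → Dec (k ≡ inject₁ k′ ⊎ k ≡ Fin.suc k′)
touches? k k′ = (k ≟ inject₁ k′) ⊎-dec (k ≟ Fin.suc k′)

∑ℕ-touches : ∀ {n} (g : Fin n → ℕ) k →
             ∑ℕ (λ k′ → if does (touches? k k′) then g k′ else 0) ≡ hdeg 0 0 g k
∑ℕ-touches {ℕ.zero} g zero        = ≡.refl
∑ℕ-touches {suc n}  g zero        = ≡.trans (cong (g zero +_) (ℕ-Sum.sum-replicate-zero n)) (ℕ.+-identityʳ _)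
∑ℕ-touches {suc n}  g (Fin.suc k) =
  ≡.trans (cong ((if does (k ≟ zero) then g zero else 0) +_) (∑ℕ-touches (tail g) k))
          (≡.sym (hdeg-left (g zero) 0 (tail g) k))

∑ℕ-select : ∀ {n} (f : Fin n → ℕ) k → ∑ℕ (λ k′ → if does (k ≟ k′) then f k′ else 0) ≡ f k
∑ℕ-select {suc n} f zero        = ≡.trans (cong (f zero +_) (ℕ-Sum.sum-replicate-zero n)) (ℕ.+-identityʳ _)
∑ℕ-select {suc n} f (Fin.suc k) = ∑ℕ-select (tail f) k

deg-mkω : ∀ {n} f g h (v : Vertex n) →
          deg (mkω f g h) v ≡ ∑ℕ (λ k → if does (incident? v (vert k)) then f k else 0)
                            + (∑ℕ (λ k → if does (incident? v (top k)) then g k else 0)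
                            +  ∑ℕ (λ k → if does (incident? v (bot k)) then h k else 0))
deg-mkω {n} f g h v =
  ≡.trans (ℕ-Fold.fold-filter (incident? v) (mkω f g h) (allEdges n)) (ℕ-Fold.fold-allEdges n _)

deg-bottom : ∀ {n} f g h (k : Fin (suc n)) → deg (mkω f g h) (zero , k) ≡ f k + hdeg 0 0 h k
deg-bottom {n} f g h k = ≡.trans (deg-mkω f g h (zero , k)) (cong₂ _+_ vertical horizontal)
  where
  vertical : ∑ℕ (λ k′ → if does (k ≟ k′) ∨ false then f k′ else 0) ≡ f k
  vertical = ≡.trans (ℕ-Sum.sum-cong-≗ (λ k′ → cong (if_then f k′ else 0) (∨-identityʳ (does (k ≟ k′)))))
                     (∑ℕ-select f k)
  horizontal : ∑ℕ {n} (λ _ → 0) + ∑ℕ (λ k′ → if does (touches? k k′) then h k′ else 0) ≡ hdeg 0 0 h k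
  horizontal = ≡.trans (cong (_+ ∑ℕ (λ k′ → if does (touches? k k′) then h k′ else 0))
                             (ℕ-Sum.sum-replicate-zero n))
                       (∑ℕ-touches h k)

deg-top : ∀ {n} f g h (k : Fin (suc n)) → deg (mkω f g h) (Fin.suc zero , k) ≡ f k + hdeg 0 0 g k
deg-top {n} f g h k = ≡.trans (deg-mkω f g h (Fin.suc zero , k)) (cong₂ _+_ (∑ℕ-select f k) horizontal)
  where
  horizontal : ∑ℕ (λ k′ → if does (touches? k k′) then g k′ else 0) + ∑ℕ {n} (λ _ → 0) ≡ hdeg 0 0 g k
  horizontal = ≡.trans (cong₂ _+_ (∑ℕ-touches g k) (ℕ-Sum.sum-replicate-zero n)) (ℕ.+-identityʳ _)

isCover⇔ : ∀ {n} (x : Fin (suc n) → ℕ) (ω : Edge n → ℕ) →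
           IsCover (nx x) ω ⇔ ((∀ k → deg ω (zero , k) ≡ x k) × (∀ k → deg ω (Fin.suc zero , k) ≡ x k))
isCover⇔ {n} x ω = mk⇔ to from
  where
  to : IsCover (nx x) ω → (∀ k → deg ω (zero , k) ≡ x k) × (∀ k → deg ω (Fin.suc zero , k) ≡ x k)
  to cover with All.++⁻ (map (zero ,_) (allFin (suc n))) cover
  ... | lower , rest = All.tabulate⁻ (All.map⁻ lower) , All.tabulate⁻ (All.map⁻ (All.++⁻ˡ _ rest))
  from : (∀ k → deg ω (zero , k) ≡ x k) × (∀ k → deg ω (Fin.suc zero , k) ≡ x k) → IsCover (nx x) ω
  from (lower , upper) =
    All.++⁺ (All.map⁺ (All.tabulate⁺ lower)) (All.++⁺ (All.map⁺ (All.tabulate⁺ upper)) All.[])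

mkω-isCover⇔ : ∀ {n} (x : Fin (suc n) → ℕ) f (g h : Fin n → ℕ) →
               IsCover (nx x) (mkω f g h) ⇔ ((∀ k → h k ≡ g k) × (∀ k → f k + hdeg 0 0 g k ≡ x k))
mkω-isCover⇔ x f g h = mk⇔ (to ∘ Equivalence.to (isCover⇔ x _)) (Equivalence.from (isCover⇔ x _) ∘ from)
  where
  RowDegrees = (∀ k → deg (mkω f g h) (zero , k) ≡ x k) × (∀ k → deg (mkω f g h) (Fin.suc zero , k) ≡ x k)
  to : RowDegrees → (∀ k → h k ≡ g k) × (∀ k → f k + hdeg 0 0 g k ≡ x k)
  to (lower , upper) =
    hdeg-injective 0 0 (λ k → ℕ.+-cancelˡ-≡ (f k) _ _ (≡.trans (lower′ k) (≡.sym (upper′ k)))) , upper′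
    where
    lower′ = λ k → ≡.trans (≡.sym (deg-bottom f g h k)) (lower k)
    upper′ = λ k → ≡.trans (≡.sym (deg-top f g h k)) (upper k)
  from : (∀ k → h k ≡ g k) × (∀ k → f k + hdeg 0 0 g k ≡ x k) → RowDegrees
  from (h≗g , vertical) =
    (λ k → ≡.trans (deg-bottom f g h k) (≡.trans (cong (f k +_) (hdeg-cong 0 0 h≗g k)) (vertical k))) ,
    (λ k → ≡.trans (deg-top f g h k) (vertical k))

module _ {n} (m : Fin (suc (suc n)) → ℕ) (i : Fin (suc (m zero))) (j : Fin (suc (m (fromℕ (suc n))))) where

  shiftEnds-last : shiftEnds (suc n) m i j (fromℕ (suc n)) ≡ m (fromℕ (suc n)) ∸ toℕ j
  shiftEnds-last = cong (if_then m (fromℕ (suc n)) ∸ toℕ j else m (fromℕ (suc n)))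
                        (dec-true (toℕ (fromℕ n) ℕ.≟ n) (toℕ-fromℕ n))

  shiftEnds-inner : ∀ k → shiftEnds (suc n) m i j (Fin.suc (inject₁ k)) ≡ m (Fin.suc (inject₁ k))
  shiftEnds-inner k = cong (if_then m (fromℕ (suc n)) ∸ toℕ j else m (Fin.suc (inject₁ k)))
                           (dec-false (toℕ (inject₁ k) ℕ.≟ n) (ℕ.<⇒≢ inject₁k<n))
    where
    inject₁k<n = ≡.subst (_< n) (≡.sym (toℕ-inject₁ k)) (toℕ<n k)

  shiftEnds-≤ : ∀ k → shiftEnds (suc n) m i j (Fin.suc k) ≤ m (Fin.suc k)
  shiftEnds-≤ k with view k
  ... | ‵fromℕ      = ≡.subst (_≤ m (fromℕ (suc n))) (≡.sym shiftEnds-last) (ℕ.m∸n≤m _ (toℕ j))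
  ... | ‵inject₁ k′ = ℕ.≤-reflexive (shiftEnds-inner k′)

-- The base case reuses the empty function of boundedFuns (distinct absurd lambdas are not
-- definitionally equal), so that boundedFuns n B is boxFuns (λ _ → B).
boxFuns : ∀ {n} → (Fin n → ℕ) → List (Fin n → ℕ)
boxFuns {ℕ.zero} β = boundedFuns 0 0
boxFuns {suc n}  β = concatMap (λ v → map (v Vec.∷_) (boxFuns (tail β))) (upTo (suc (β zero)))

boundedFuns≡boxFuns : ∀ n B → boundedFuns n B ≡ boxFuns {n} (λ _ → B)
boundedFuns≡boxFuns ℕ.zero  B = ≡.refl
boundedFuns≡boxFuns (suc n) B =
  cong (λ fs → concatMap (λ v → map (v Vec.∷_) fs) (upTo (suc B))) (boundedFuns≡boxFuns n B)

module _ {r ℓ : Level} (R : CommutativeSemiring r ℓ) where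
  open CommutativeSemiring R renaming (Carrier to C; _+_ to _⊕_) hiding (zero)
  open import Algebra.Properties.Semiring.Sum semiring
    using (sum; sum-syntax; sum-cong-≋; sum-cong-≗; sum-replicate-zero; ∑-comm; *-distribˡ-sum; *-distribʳ-sum)
  module ∏ = CommutativeMonoidSum *-commutativeMonoid
  open ∏ using () renaming (sum to product)
  module Σᴸ = ListFold +-monoid
  module Πᴸ = ListFold *-monoid
  open import Algebra.Properties.CommutativeSemigroup *-commutativeSemigroup using (interchange; x∙yz≈y∙xz)
  open import Relation.Binary.Reasoning.Setoid setoid

  boxSum : ∀ {n} → (Fin n → ℕ) → ((Fin n → ℕ) → C) → C
  boxSum β F = sum (F ∘ lookup (boxFuns β))

  boxSum-suc : ∀ {n} (β : Fin (suc n) → ℕ) F →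
               boxSum β F ≈ ∑[ v < suc (β zero) ] boxSum (tail β) (λ g → F (toℕ v Vec.∷ g))
  boxSum-suc β F = begin
    sum (F ∘ lookup (boxFuns β))
      ≡⟨ ≡.sym (Σᴸ.fold-lookup F (boxFuns β)) ⟩
    Σᴸ.fold (map F (boxFuns β))
      ≈⟨ Σᴸ.fold-concatMap F (λ v → map (v Vec.∷_) (boxFuns (tail β))) (upTo (suc (β zero))) ⟩
    Σᴸ.fold (map (λ v → Σᴸ.fold (map F (map (v Vec.∷_) (boxFuns (tail β))))) (upTo (suc (β zero))))
      ≡⟨ cong Σᴸ.fold (List.map-cong row (upTo (suc (β zero)))) ⟩
    Σᴸ.fold (map (λ v → boxSum (tail β) (λ g → F (v Vec.∷ g))) (upTo (suc (β zero))))
      ≡⟨ Σᴸ.fold-applyUpTo (suc (β zero)) _ id ⟩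
    ∑[ v < suc (β zero) ] boxSum (tail β) (λ g → F (toℕ v Vec.∷ g)) ∎
    where
    row : ∀ v → Σᴸ.fold (map F (map (v Vec.∷_) (boxFuns (tail β)))) ≡ boxSum (tail β) (λ g → F (v Vec.∷ g))
    row v = ≡.trans (cong Σᴸ.fold (≡.sym (List.map-∘ (boxFuns (tail β)))))
                    (Σᴸ.fold-lookup (λ g → F (v Vec.∷ g)) (boxFuns (tail β)))

  boxSum-cong : ∀ {n} (β : Fin n → ℕ) {F G : (Fin n → ℕ) → C} →
                (∀ g → F g ≈ G g) → boxSum β F ≈ boxSum β G
  boxSum-cong β F≈G = sum-cong-≋ {length (boxFuns β)} (λ i → F≈G (lookup (boxFuns β) i))

  boxSum-cong-≤ : ∀ {n} (β : Fin n → ℕ) {F G : (Fin n → ℕ) → C} →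
                  (∀ g → (∀ k → g k ≤ β k) → F g ≈ G g) → boxSum β F ≈ boxSum β G
  boxSum-cong-≤ {ℕ.zero} β F≈G = +-congʳ (F≈G _ (λ ()))
  boxSum-cong-≤ {suc n}  β {F} {G} F≈G = begin
    boxSum β F
      ≈⟨ boxSum-suc β F ⟩
    ∑[ v < suc (β zero) ] boxSum (tail β) (λ g → F (toℕ v Vec.∷ g))
      ≈⟨ sum-cong-≋ {suc (β zero)} (λ v → boxSum-cong-≤ (tail β) (λ g → F≈G _ ∘ cons-≤ v g)) ⟩
    ∑[ v < suc (β zero) ] boxSum (tail β) (λ g → G (toℕ v Vec.∷ g))
      ≈⟨ sym (boxSum-suc β G) ⟩
    boxSum β G ∎
    where
    cons-≤ : ∀ (v : Fin (suc (β zero))) g → (∀ k → g k ≤ tail β k) → ∀ k → (toℕ v Vec.∷ g) k ≤ β k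
    cons-≤ v g g≤β zero        = toℕ≤pred[n] v
    cons-≤ v g g≤β (Fin.suc k) = g≤β k

  boxSum-zero : ∀ {n} (β : Fin n → ℕ) → boxSum β (λ _ → 0#) ≈ 0#
  boxSum-zero β = sum-replicate-zero (length (boxFuns β))

  boxSum-*ˡ : ∀ {n} (β : Fin n → ℕ) x (F : (Fin n → ℕ) → C) → x * boxSum β F ≈ boxSum β (λ g → x * F g)
  boxSum-*ˡ β x F = *-distribˡ-sum x (F ∘ lookup (boxFuns β))

  boxSum-*ʳ : ∀ {n} (β : Fin n → ℕ) x (F : (Fin n → ℕ) → C) → boxSum β F * x ≈ boxSum β (λ g → F g * x)
  boxSum-*ʳ β x F = *-distribʳ-sum x (F ∘ lookup (boxFuns β))

  boxSum-comm : ∀ {n n′} (β : Fin n → ℕ) (γ : Fin n′ → ℕ) (F : (Fin n → ℕ) → (Fin n′ → ℕ) → C) →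
                boxSum β (λ f → boxSum γ (F f)) ≈ boxSum γ (λ g → boxSum β (λ f → F f g))
  boxSum-comm β γ F =
    ∑-comm {length (boxFuns β)} {length (boxFuns γ)} (λ i j → F (lookup (boxFuns β) i) (lookup (boxFuns γ) j))

  product-zero : ∀ {n} (f : Fin n → C) k → f k ≈ 0# → product f ≈ 0#
  product-zero f zero        fk≈0 = trans (*-congʳ fk≈0) (zeroˡ _)
  product-zero f (Fin.suc k) fk≈0 = trans (*-congˡ (product-zero (tail f) k fk≈0)) (zeroʳ _)

  boxSum-product : ∀ {n} (β : Fin n → ℕ) (φ : Fin n → ℕ → C) →
                   boxSum β (λ g → product (λ k → φ k (g k)))
                     ≈ product (λ k → ∑[ v < suc (β k) ] φ k (toℕ v))
  boxSum-product {ℕ.zero} β φ = +-identityʳ 1#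
  boxSum-product {suc n}  β φ = begin
    boxSum β (λ g → product (λ k → φ k (g k)))
      ≈⟨ boxSum-suc β (λ g → product (λ k → φ k (g k))) ⟩
    ∑[ v < suc (β zero) ] boxSum (tail β) (λ g → φ zero (toℕ v) * product′ g)
      ≈⟨ sum-cong-≋ {suc (β zero)} (λ v → sym (boxSum-*ˡ (tail β) (φ zero (toℕ v)) product′)) ⟩
    ∑[ v < suc (β zero) ] (φ zero (toℕ v) * boxSum (tail β) product′)
      ≈⟨ sum-cong-≋ {suc (β zero)} (λ v → *-congˡ {φ zero (toℕ v)}
                                              (boxSum-product (tail β) (φ ∘ Fin.suc))) ⟩
    ∑[ v < suc (β zero) ] (φ zero (toℕ v) * rest)
      ≈⟨ sym (*-distribʳ-sum {suc (β zero)} rest (λ v → φ zero (toℕ v))) ⟩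
    (∑[ v < suc (β zero) ] φ zero (toℕ v)) * rest ∎
    where
    product′ : (Fin n → ℕ) → C
    product′ g = product (λ k → φ (Fin.suc k) (g k))
    rest = product (λ k → ∑[ v < suc (β (Fin.suc k)) ] φ (Fin.suc k) (toℕ v))

  ∑-truncate : ∀ {k l} (G : ℕ → C) → l ≤ k → (∀ v → l ≤ v → G v ≈ 0#) →
               ∑[ v < k ] G (toℕ v) ≈ ∑[ v < l ] G (toℕ v)
  ∑-truncate {k}     {ℕ.zero} G z≤n       G≈0 =
    trans (sum-cong-≋ {k} (λ v → G≈0 (toℕ v) z≤n)) (sum-replicate-zero k)
  ∑-truncate {suc k} {suc l}  G (s≤s l≤k) G≈0 =
    +-congˡ (∑-truncate (G ∘ suc) l≤k (λ v → G≈0 (suc v) ∘ s≤s))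

  boxSum-shrink : ∀ {n} {β γ : Fin n → ℕ} F → (∀ k → γ k ≤ β k) → (∀ g k → γ k < g k → F g ≈ 0#) →
                  boxSum β F ≈ boxSum γ F
  boxSum-shrink {ℕ.zero}        F γ≤β F≈0 = refl
  boxSum-shrink {suc n} {β} {γ} F γ≤β F≈0 = begin
    boxSum β F
      ≈⟨ boxSum-suc β F ⟩
    ∑[ v < suc (β zero) ] boxSum (tail β) (F ∘ (toℕ v Vec.∷_))
      ≈⟨ sum-cong-≋ {suc (β zero)} (λ v → boxSum-shrink (F ∘ (toℕ v Vec.∷_)) (γ≤β ∘ Fin.suc)
                                                        (λ g k → F≈0 (toℕ v Vec.∷ g) (Fin.suc k))) ⟩
    ∑[ v < suc (β zero) ] boxSum (tail γ) (F ∘ (toℕ v Vec.∷_))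
      ≈⟨ ∑-truncate (λ v → boxSum (tail γ) (F ∘ (v Vec.∷_))) (s≤s (γ≤β zero)) outside ⟩
    ∑[ v < suc (γ zero) ] boxSum (tail γ) (F ∘ (toℕ v Vec.∷_))
      ≈⟨ sym (boxSum-suc γ F) ⟩
    boxSum γ F ∎
    where
    outside : ∀ v → suc (γ zero) ≤ v → boxSum (tail γ) (F ∘ (v Vec.∷_)) ≈ 0#
    outside v γ₀<v = trans (boxSum-cong (tail γ) (λ g → F≈0 (v Vec.∷ g) zero γ₀<v)) (boxSum-zero (tail γ))

  𝟙 : Bool → C
  𝟙 b = if b then 1# else 0#

  if-𝟙 : ∀ b x → (if b then x else 0#) ≈ 𝟙 b * x
  if-𝟙 true  x = sym (*-identityˡ x)
  if-𝟙 false x = sym (zeroˡ x)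

  𝟙-∧ : ∀ b b′ → 𝟙 (b ∧ b′) ≈ 𝟙 b * 𝟙 b′
  𝟙-∧ true  b′ = sym (*-identityˡ _)
  𝟙-∧ false b′ = sym (zeroˡ _)

  𝟙-all : ∀ {n p} {P : Pred (Fin n) p} (P? : Decidable P) →
          𝟙 (does (all? P?)) ≈ product (λ k → 𝟙 (does (P? k)))
  𝟙-all {ℕ.zero} P? = refl
  𝟙-all {suc n}  P? = begin
    𝟙 (does (all? P?))
      ≡⟨ cong 𝟙 (≡.sym (does-⇔ ∀-cons-⇔ (P? zero ×-dec all? (P? ∘ Fin.suc)) (all? P?))) ⟩
    𝟙 (does (P? zero) ∧ does (all? (P? ∘ Fin.suc)))
      ≈⟨ 𝟙-∧ _ _ ⟩
    𝟙 (does (P? zero)) * 𝟙 (does (all? (P? ∘ Fin.suc)))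
      ≈⟨ *-congˡ (𝟙-all (P? ∘ Fin.suc)) ⟩
    product (λ k → 𝟙 (does (P? k))) ∎

  ∑-δ : ∀ k s (G : ℕ → C) → (k ≤ s → G s ≈ 0#) →
        ∑[ v < k ] (𝟙 (toℕ v ≡ᵇ s) * G (toℕ v)) ≈ G s
  ∑-δ ℕ.zero  s       G G≈0 = sym (G≈0 z≤n)
  ∑-δ (suc k) ℕ.zero  G G≈0 = begin
    𝟙 true * G 0 ⊕ ∑[ v < k ] (𝟙 false * G (suc (toℕ v)))
      ≈⟨ +-cong (*-identityˡ _)
                (trans (sum-cong-≋ {k} (λ v → zeroˡ (G (suc (toℕ v))))) (sum-replicate-zero k)) ⟩
    G 0 ⊕ 0#
      ≈⟨ +-identityʳ _ ⟩
    G 0 ∎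
  ∑-δ (suc k) (suc s) G G≈0 = trans (+-cong (zeroˡ _) (∑-δ k s (G ∘ suc) (G≈0 ∘ s≤s))) (+-identityˡ _)

  pow-* : ∀ x y k → pow R (x * y) k ≈ pow R x k * pow R y k
  pow-* x y ℕ.zero  = sym (*-identityˡ 1#)
  pow-* x y (suc k) = trans (*-congˡ (pow-* x y k)) (interchange x y _ _)

  uEntry : ℕ → C → ℕ → C
  uEntry N t s = if s ℕ.≤ᵇ N then pow R t (N ∸ s) else 0#

  uEntry-≤ : ∀ {N s} t → s ≤ N → uEntry N t s ≡ pow R t (N ∸ s)
  uEntry-≤ {N} {s} t s≤N = cong (if_then pow R t (N ∸ s) else 0#) (dec-true (s ℕ.≤? N) s≤N)

  uEntry-> : ∀ {N s} t → N < s → uEntry N t s ≡ 0#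
  uEntry-> {N} {s} t N<s = cong (if_then pow R t (N ∸ s) else 0#) (dec-false (s ℕ.≤? N) (ℕ.<⇒≱ N<s))

  uEntry-∸ : ∀ {N s′} t s → s′ ≤ N → uEntry (N ∸ s′) t s ≡ uEntry N t (s′ + s)
  uEntry-∸ {N} {s′} t s s′≤N with s ℕ.≤? N ∸ s′
  ... | yes s≤N∸s′ = ≡.trans (uEntry-≤ t s≤N∸s′)
                       (≡.trans (cong (pow R t) (ℕ.∸-+-assoc N s′ s)) (≡.sym (uEntry-≤ t s′+s≤N)))
    where
    s′+s≤N = ℕ.≤-trans (ℕ.+-monoʳ-≤ s′ s≤N∸s′) (ℕ.≤-reflexive (ℕ.m+[n∸m]≡n s′≤N))
  ... | no  s≰N∸s′ = ≡.trans (uEntry-> t N∸s′<s) (≡.sym (uEntry-> t N<s′+s))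
    where
    N∸s′<s = ℕ.≰⇒> s≰N∸s′
    N<s′+s = ℕ.≤-trans (s≤s (ℕ.≤-reflexive (≡.sym (ℕ.m+[n∸m]≡n s′≤N)))) (ℕ.+-monoʳ-< s′ N∸s′<s)

  ∑-δ-uEntry : ∀ {B X} s t → X ≤ B →
               ∑[ v < suc B ] (𝟙 (toℕ v + s ≡ᵇ X) * pow R t (toℕ v)) ≈ uEntry X t s
  ∑-δ-uEntry {B} {X} s t X≤B with s ℕ.≤? X
  ... | yes s≤X = begin
    ∑[ v < suc B ] (𝟙 (toℕ v + s ≡ᵇ X) * pow R t (toℕ v))
      ≡⟨ sum-cong-≗ {suc B} (λ v → cong (λ b → 𝟙 b * pow R t (toℕ v))
                                         (does-⇔ (+s≡X⇔ (toℕ v)) (toℕ v + s ℕ.≟ X) (toℕ v ℕ.≟ X ∸ s))) ⟩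
    ∑[ v < suc B ] (𝟙 (toℕ v ≡ᵇ X ∸ s) * pow R t (toℕ v))
      ≈⟨ ∑-δ (suc B) (X ∸ s) (pow R t) (λ B<X∸s → ⊥-elim (ℕ.<⇒≱ B<X∸s X∸s≤B)) ⟩
    pow R t (X ∸ s)
      ≡⟨ ≡.sym (uEntry-≤ t s≤X) ⟩
    uEntry X t s ∎
    where
    X∸s≤B = ℕ.≤-trans (ℕ.m∸n≤m X s) X≤B
    +s≡X⇔ : ∀ v → (v + s ≡ X) ⇔ (v ≡ X ∸ s)
    +s≡X⇔ v = mk⇔ (λ v+s≡X → ≡.trans (≡.sym (ℕ.m+n∸n≡m v s)) (cong (_∸ s) v+s≡X))
                  (λ v≡X∸s → ≡.trans (cong (_+ s) v≡X∸s) (ℕ.m∸n+n≡m s≤X))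
  ... | no  s≰X = begin
    ∑[ v < suc B ] (𝟙 (toℕ v + s ≡ᵇ X) * pow R t (toℕ v))
      ≈⟨ sum-cong-≋ {suc B} (λ v → trans (*-congʳ (reflexive (cong 𝟙 (v+s≢X (toℕ v)))))
                                         (zeroˡ (pow R t (toℕ v)))) ⟩
    ∑[ v < suc B ] 0#
      ≈⟨ sum-replicate-zero (suc B) ⟩
    0#
      ≡⟨ ≡.sym (uEntry-> t (ℕ.≰⇒> s≰X)) ⟩
    uEntry X t s ∎
    where
    v+s≢X : ∀ v → (v + s ≡ᵇ X) ≡ false
    v+s≢X v = dec-false (v + s ℕ.≟ X) (λ v+s≡X → s≰X (≡.subst (s ≤_) v+s≡X (ℕ.m≤n+m s v)))

  -- The term of the expanded matrix product with outer indices p, q and intermediate indices g;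
  -- for p = q = 0 it is also the weight of the cover whose horizontal multiplicities are g.
  pathWeight : ∀ {n} (m : Fin (suc n) → ℕ) (a : Fin (suc n) → C) (b c : Fin n → C) →
               ℕ → ℕ → (Fin n → ℕ) → C
  pathWeight m a b c p q g =
    product (λ k → uEntry (m k) (a k) (hdeg p q g k)) * product (λ k → pow R (b k * c k) (g k))

  pathWeight-cons : ∀ {n} m a (b c : Fin (suc n) → C) p q v g →
    pathWeight m a b c p q (v Vec.∷ g)
      ≈ (uEntry (m zero) (a zero) (p + v) * pow R (b zero * c zero) v)
        * pathWeight (tail m) (tail a) (tail b) (tail c) v q g
  pathWeight-cons m a b c p q v g = interchange _ _ _ _

  pathWeight-support : ∀ {n} m a (b c : Fin n → C) p q g k → m (Fin.suc k) < g k → pathWeight m a b c p q g ≈ 0#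
  pathWeight-support m a b c p q g k m<g =
    trans (*-congʳ (product-zero (λ k′ → uEntry (m k′) (a k′) (hdeg p q g k′)) (Fin.suc k) column-zero)) (zeroˡ _)
    where
    column-zero = reflexive (uEntry-> (a (Fin.suc k)) (ℕ.<-≤-trans m<g (≤-hdeg-suc p q g k)))

  uEntry-shiftEnds : ∀ {n} m (i : Fin (suc (m zero))) (j : Fin (suc (m (fromℕ (suc n))))) g t k →
    uEntry (shiftEnds (suc n) m i j k) t (hdeg 0 0 g k) ≡ uEntry (m k) t (hdeg (toℕ i) (toℕ j) g k)
  uEntry-shiftEnds m i j g t zero = uEntry-∸ t (g zero) (toℕ≤pred[n] i)
  uEntry-shiftEnds {n} m i j g t (Fin.suc k) with view k
  ... | ‵fromℕ =
    ≡.trans (cong (λ M → uEntry M t (hdeg (g zero) 0 (tail g) (fromℕ n))) (shiftEnds-last m i j))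
      (≡.trans (uEntry-∸ t _ (toℕ≤pred[n] j))
               (cong (uEntry (m (fromℕ (suc n))) t) (≡.sym (hdeg-last (g zero) (toℕ j) (tail g)))))
  ... | ‵inject₁ k′ =
    ≡.trans (cong (λ M → uEntry M t (hdeg (g zero) 0 (tail g) (inject₁ k′))) (shiftEnds-inner m i j k′))
            (cong (uEntry (m (Fin.suc (inject₁ k′))) t) (hdeg-inject₁ (g zero) 0 (toℕ j) (tail g) k′))

  pathWeight-shiftEnds : ∀ {n} m a (b c : Fin (suc n) → C)
                         (i : Fin (suc (m zero))) (j : Fin (suc (m (fromℕ (suc n))))) g →
    pathWeight (shiftEnds (suc n) m i j) a b c 0 0 g ≈ pathWeight m a b c (toℕ i) (toℕ j) g
  pathWeight-shiftEnds m a b c i j g = *-congʳ (reflexive (∏.sum-cong-≗ (λ k → uEntry-shiftEnds m i j g (a k) k)))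

  -- The matrix side

  U⊗T-entry : ∀ M M′ t s (i : Fin (suc M)) (l : Fin (suc M′)) →
              _⊗_ R (U R M t) (T R M M′ s) i l ≈ uEntry M t (toℕ i + toℕ l) * pow R s (toℕ l)
  U⊗T-entry M M′ t s i l = begin
    _⊗_ R (U R M t) (T R M M′ s) i l
      ≡⟨ Σᴸ.fold-tabulate (λ l′ → U R M t i l′ * T R M M′ s l′ l) id ⟩
    ∑[ l′ < suc M ] (uEntry M t (toℕ i + toℕ l′) * (if toℕ l′ ≡ᵇ toℕ l then pow R s (toℕ l′) else 0#))
      ≈⟨ sum-cong-≋ {suc M} (λ l′ → trans (*-congˡ (if-𝟙 (toℕ l′ ≡ᵇ toℕ l) (pow R s (toℕ l′))))
                                          (x∙yz≈y∙xz (uEntry M t (toℕ i + toℕ l′)) _ _)) ⟩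
    ∑[ l′ < suc M ] (𝟙 (toℕ l′ ≡ᵇ toℕ l) * (uEntry M t (toℕ i + toℕ l′) * pow R s (toℕ l′)))
      ≈⟨ ∑-δ (suc M) (toℕ l) (λ v → uEntry M t (toℕ i + v) * pow R s v) beyond ⟩
    uEntry M t (toℕ i + toℕ l) * pow R s (toℕ l) ∎
    where
    beyond : suc M ≤ toℕ l → uEntry M t (toℕ i + toℕ l) * pow R s (toℕ l) ≈ 0#
    beyond M<l = trans (*-congʳ (reflexive (uEntry-> t (ℕ.<-≤-trans M<l (ℕ.m≤n+m (toℕ l) (toℕ i)))))) (zeroˡ _)

  Xmat-entry : ∀ n m a (b c : Fin n → C) (i : Fin (suc (m zero))) (j : Fin (suc (m (fromℕ n)))) →
               Xmat R n m a b c i j ≈ boxSum (m ∘ Fin.suc) (pathWeight m a b c (toℕ i) (toℕ j))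
  Xmat-entry ℕ.zero  m a b c i j = sym (trans (+-identityʳ _) (trans (*-identityʳ _) (*-identityʳ _)))
  Xmat-entry (suc n) m a b c i j = begin
    Xmat R (suc n) m a b c i j
      ≡⟨ Σᴸ.fold-tabulate (λ l → UT i l * X′ l j) id ⟩
    ∑[ l < suc M₁ ] (UT i l * X′ l j)
      ≈⟨ sum-cong-≋ {suc M₁} (λ l → *-cong (U⊗T-entry (m zero) M₁ (a zero) (b zero * c zero) i l)
                                             (Xmat-entry n (tail m) (tail a) (tail b) (tail c) l j)) ⟩
    ∑[ l < suc M₁ ] (step (toℕ l) * boxSum β′ (rest (toℕ l)))
      ≈⟨ sum-cong-≋ {suc M₁} (λ l → boxSum-*ˡ β′ (step (toℕ l)) (rest (toℕ l))) ⟩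
    ∑[ l < suc M₁ ] boxSum β′ (λ g → step (toℕ l) * rest (toℕ l) g)
      ≈⟨ sum-cong-≋ {suc M₁} (λ l → boxSum-cong β′ (λ g →
                               sym (pathWeight-cons m a b c (toℕ i) (toℕ j) (toℕ l) g))) ⟩
    ∑[ l < suc M₁ ] boxSum β′ (λ g → pathWeight m a b c (toℕ i) (toℕ j) (toℕ l Vec.∷ g))
      ≈⟨ sym (boxSum-suc (m ∘ Fin.suc) (pathWeight m a b c (toℕ i) (toℕ j))) ⟩
    boxSum (m ∘ Fin.suc) (pathWeight m a b c (toℕ i) (toℕ j)) ∎
    where
    M₁ = m (Fin.suc zero)
    β′ = tail (m ∘ Fin.suc)
    UT = _⊗_ R (U R (m zero) (a zero)) (T R (m zero) M₁ (b zero * c zero))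
    X′ = Xmat R n (tail m) (tail a) (tail b) (tail c)
    step : ℕ → C
    step v = uEntry (m zero) (a zero) (toℕ i + v) * pow R (b zero * c zero) v
    rest : ℕ → (Fin n → ℕ) → C
    rest v = pathWeight (tail m) (tail a) (tail b) (tail c) v (toℕ j)

  -- The cover side

  fold-boundedFuns : ∀ k B (F : (Fin k → ℕ) → C) → Σᴸ.fold (map F (boundedFuns k B)) ≡ boxSum (λ _ → B) F
  fold-boundedFuns k B F =
    ≡.trans (cong (Σᴸ.fold ∘ map F) (boundedFuns≡boxFuns k B)) (Σᴸ.fold-lookup F (boxFuns (λ _ → B)))

  fold-boundedω : ∀ n B (F : (Edge n → ℕ) → C) →
    Σᴸ.fold (map F (boundedω n B))
      ≈ boxSum (λ _ → B) (λ f → boxSum (λ _ → B) (λ g → boxSum (λ _ → B) (λ h → F (mkω f g h))))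
  fold-boundedω n B F = begin
    Σᴸ.fold (map F (concatMap (λ f → concatMap (row f) (boundedFuns n B)) (boundedFuns (suc n) B)))
      ≈⟨ Σᴸ.fold-concatMap F _ (boundedFuns (suc n) B) ⟩
    Σᴸ.fold (map (λ f → Σᴸ.fold (map F (concatMap (row f) (boundedFuns n B)))) (boundedFuns (suc n) B))
      ≡⟨ fold-boundedFuns (suc n) B _ ⟩
    boxSum B̄ (λ f → Σᴸ.fold (map F (concatMap (row f) (boundedFuns n B))))
      ≈⟨ boxSum-cong B̄ inner ⟩
    boxSum B̄ (λ f → boxSum B̄ (λ g → boxSum B̄ (λ h → F (mkω f g h)))) ∎
    where
    B̄ : ∀ {k} → Fin k → ℕ
    B̄ _ = B
    row : (Fin (suc n) → ℕ) → (Fin n → ℕ) → List (Edge n → ℕ)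
    row f g = map (mkω f g) (boundedFuns n B)
    inner : ∀ f → Σᴸ.fold (map F (concatMap (row f) (boundedFuns n B)))
                    ≈ boxSum B̄ (λ g → boxSum B̄ (λ h → F (mkω f g h)))
    inner f = begin
      Σᴸ.fold (map F (concatMap (row f) (boundedFuns n B)))
        ≈⟨ Σᴸ.fold-concatMap F (row f) (boundedFuns n B) ⟩
      Σᴸ.fold (map (λ g → Σᴸ.fold (map F (row f g))) (boundedFuns n B))
        ≡⟨ cong Σᴸ.fold (List.map-cong (λ g → cong Σᴸ.fold (≡.sym (List.map-∘ (boundedFuns n B))))
                                        (boundedFuns n B)) ⟩
      Σᴸ.fold (map (λ g → Σᴸ.fold (map (F ∘ mkω f g) (boundedFuns n B))) (boundedFuns n B))
        ≡⟨ cong Σᴸ.fold (List.map-cong (λ g → fold-boundedFuns n B (F ∘ mkω f g)) (boundedFuns n B)) ⟩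
      Σᴸ.fold (map (λ g → boxSum B̄ (F ∘ mkω f g)) (boundedFuns n B))
        ≡⟨ fold-boundedFuns n B _ ⟩
      boxSum B̄ (λ g → boxSum B̄ (λ h → F (mkω f g h))) ∎

  wt-mkω : ∀ {n} a (b c : Fin n → C) f g h →
           wt R a b c (mkω f g h)
             ≈ product (λ k → pow R (a k) (f k))
               * (product (λ k → pow R (b k) (g k)) * product (λ k → pow R (c k) (h k)))
  wt-mkω {n} a b c f g h = Πᴸ.fold-allEdges n (λ e → pow R (edgeWt R a b c e) (mkω f g h e))

  coverWeight-factor : ∀ {n} x a (b c : Fin n → C) f g h →
    (if does (isCover? (nx x) (mkω f g h)) then wt R a b c (mkω f g h) else 0#)
      ≈ product (λ k → 𝟙 (f k + hdeg 0 0 g k ≡ᵇ x k) * pow R (a k) (f k))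
        * (product (λ k → pow R (b k) (g k)) * product (λ k → 𝟙 (h k ≡ᵇ g k) * pow R (c k) (h k)))
  coverWeight-factor x a b c f g h = begin
    (if does (isCover? (nx x) (mkω f g h)) then wt R a b c (mkω f g h) else 0#)
      ≈⟨ if-𝟙 _ _ ⟩
    𝟙 (does (isCover? (nx x) (mkω f g h))) * wt R a b c (mkω f g h)
      ≡⟨ cong (λ covered → 𝟙 covered * wt R a b c (mkω f g h))
              (does-⇔ (mkω-isCover⇔ x f g h) (isCover? (nx x) (mkω f g h)) (same? ×-dec vertical?)) ⟩
    𝟙 (does same? ∧ does vertical?) * wt R a b c (mkω f g h)
      ≈⟨ *-cong (trans (𝟙-∧ _ _) (*-cong (𝟙-all (λ k → h k ℕ.≟ g k))
                                          (𝟙-all (λ k → f k + hdeg 0 0 g k ℕ.≟ x k))))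
                (wt-mkω a b c f g h) ⟩
    (H * V) * (A * (Bg * Ch))
      ≈⟨ solve 5 (λ H V A Bg Ch → (H · V) · (A · (Bg · Ch)) ⊜ (V · A) · (Bg · (H · Ch))) refl H V A Bg Ch ⟩
    (V * A) * (Bg * (H * Ch))
      ≈⟨ *-cong (sym (∏.∑-distrib-+ (λ k → 𝟙 (f k + hdeg 0 0 g k ≡ᵇ x k)) (λ k → pow R (a k) (f k))))
                (*-congˡ (sym (∏.∑-distrib-+ (λ k → 𝟙 (h k ≡ᵇ g k)) (λ k → pow R (c k) (h k))))) ⟩
    product (λ k → 𝟙 (f k + hdeg 0 0 g k ≡ᵇ x k) * pow R (a k) (f k))
      * (Bg * product (λ k → 𝟙 (h k ≡ᵇ g k) * pow R (c k) (h k))) ∎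
    where
    open import Algebra.Solver.CommutativeMonoid *-commutativeMonoid using (solve; _⊜_) renaming (_⊕_ to _·_)
    same? = all? (λ k → h k ℕ.≟ g k)
    vertical? = all? (λ k → f k + hdeg 0 0 g k ℕ.≟ x k)
    H = product (λ k → 𝟙 (h k ≡ᵇ g k))
    V = product (λ k → 𝟙 (f k + hdeg 0 0 g k ≡ᵇ x k))
    A = product (λ k → pow R (a k) (f k))
    Bg = product (λ k → pow R (b k) (g k))
    Ch = product (λ k → pow R (c k) (h k))

  coverSum-fixedTop : ∀ {n} x a (b c : Fin n → C) B → (∀ k → x k ≤ B) → ∀ g → (∀ k → g k ≤ B) →
    boxSum (λ _ → B) (λ f → boxSum (λ _ → B) (λ h →
      if does (isCover? (nx x) (mkω f g h)) then wt R a b c (mkω f g h) else 0#))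
      ≈ pathWeight x a b c 0 0 g
  coverSum-fixedTop x a b c B x≤B g g≤B = begin
    boxSum B̄ (λ f → boxSum B̄ (λ h → if does (isCover? (nx x) (mkω f g h)) then wt R a b c (mkω f g h) else 0#))
      ≈⟨ boxSum-cong B̄ (λ f → boxSum-cong B̄ (coverWeight-factor x a b c f g)) ⟩
    boxSum B̄ (λ f → boxSum B̄ (λ h → V f * (Bg * H h)))
      ≈⟨ boxSum-cong B̄ (λ f → trans (sym (boxSum-*ˡ B̄ (V f) (λ h → Bg * H h)))
                                    (*-congˡ (sym (boxSum-*ˡ B̄ Bg H)))) ⟩
    boxSum B̄ (λ f → V f * (Bg * boxSum B̄ H))
      ≈⟨ sym (boxSum-*ʳ B̄ (Bg * boxSum B̄ H) V) ⟩
    boxSum B̄ V * (Bg * boxSum B̄ H)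
      ≈⟨ *-cong (boxSum-product B̄ (λ k v → 𝟙 (v + hdeg 0 0 g k ≡ᵇ x k) * pow R (a k) v))
                (*-congˡ (boxSum-product B̄ (λ k v → 𝟙 (v ≡ᵇ g k) * pow R (c k) v))) ⟩
    product (λ k → ∑[ v < suc B ] (𝟙 (toℕ v + hdeg 0 0 g k ≡ᵇ x k) * pow R (a k) (toℕ v)))
      * (Bg * product (λ k → ∑[ v < suc B ] (𝟙 (toℕ v ≡ᵇ g k) * pow R (c k) (toℕ v))))
      ≈⟨ *-cong (∏.sum-cong-≋ (λ k → ∑-δ-uEntry (hdeg 0 0 g k) (a k) (x≤B k)))
                (*-congˡ (∏.sum-cong-≋ (λ k → ∑-δ (suc B) (g k) (pow R (c k))
                                                    (λ B<g → ⊥-elim (ℕ.<⇒≱ B<g (g≤B k)))))) ⟩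
    product (λ k → uEntry (x k) (a k) (hdeg 0 0 g k)) * (Bg * product (λ k → pow R (c k) (g k)))
      ≈⟨ *-congˡ (sym (trans (∏.sum-cong-≋ (λ k → pow-* (b k) (c k) (g k)))
                             (∏.∑-distrib-+ (λ k → pow R (b k) (g k)) (λ k → pow R (c k) (g k))))) ⟩
    pathWeight x a b c 0 0 g ∎
    where
    B̄ : ∀ {k} → Fin k → ℕ
    B̄ _ = B
    V : (Fin _ → ℕ) → C
    V f = product (λ k → 𝟙 (f k + hdeg 0 0 g k ≡ᵇ x k) * pow R (a k) (f k))
    Bg = product (λ k → pow R (b k) (g k))
    H : (Fin _ → ℕ) → C
    H h = product (λ k → 𝟙 (h k ≡ᵇ g k) * pow R (c k) (h k))

  Ω-sum : ∀ {n} x a (b c : Fin n → C) →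
          sumL R (map (wt R a b c) (Ω n x)) ≈ boxSum (λ _ → sumℕ (map x (allFin (suc n)))) (pathWeight x a b c 0 0)
  Ω-sum {n} x a b c = begin
    Σᴸ.fold (map (wt R a b c) (filter (isCover? (nx x)) (boundedω n B)))
      ≈⟨ Σᴸ.fold-filter (isCover? (nx x)) (wt R a b c) (boundedω n B) ⟩
    Σᴸ.fold (map Q (boundedω n B))
      ≈⟨ fold-boundedω n B Q ⟩
    boxSum B̄ (λ f → boxSum B̄ (λ g → boxSum B̄ (λ h → Q (mkω f g h))))
      ≈⟨ boxSum-comm B̄ B̄ (λ f g → boxSum B̄ (λ h → Q (mkω f g h))) ⟩
    boxSum B̄ (λ g → boxSum B̄ (λ f → boxSum B̄ (λ h → Q (mkω f g h))))
      ≈⟨ boxSum-cong-≤ B̄ (coverSum-fixedTop x a b c B (≤-sumℕ x)) ⟩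
    boxSum B̄ (pathWeight x a b c 0 0) ∎
    where
    B = sumℕ (map x (allFin (suc n)))
    B̄ : ∀ {k} → Fin k → ℕ
    B̄ _ = B
    Q : (Edge n → ℕ) → C
    Q ω = if does (isCover? (nx x) ω) then wt R a b c ω else 0#

theorem2 : {c ℓ : Level} (R : CommutativeSemiring c ℓ) (n : ℕ) → 1 ≤ n →
    (m : Fin (suc n) → ℕ) →
    (a : Fin (suc n) → CommutativeSemiring.Carrier R) →
    (b cc : Fin n → CommutativeSemiring.Carrier R) →
    (i : Fin (suc (m zero))) (j : Fin (suc (m (fromℕ n)))) →
    CommutativeSemiring._≈_ R (Xmat R n m a b cc i j)
      (sumL R (map (wt R a b cc) (Ω n (shiftEnds n m i j))))
theorem2 R (suc n) (s≤s z≤n) m a b c i j = begin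
  Xmat R (suc n) m a b c i j
    ≈⟨ Xmat-entry R (suc n) m a b c i j ⟩
  boxSum R (m ∘ Fin.suc) (pathWeight R m a b c (toℕ i) (toℕ j))
    ≈⟨ boxSum-cong R (m ∘ Fin.suc) (λ g → sym (pathWeight-shiftEnds R m a b c i j g)) ⟩
  boxSum R (m ∘ Fin.suc) P
    ≈⟨ boxSum-shrink R P (shiftEnds-≤ m i j) (pathWeight-support R x a b c 0 0) ⟩
  boxSum R (x ∘ Fin.suc) P
    ≈⟨ sym (boxSum-shrink R P (≤-sumℕ x ∘ Fin.suc) (pathWeight-support R x a b c 0 0)) ⟩
  boxSum R (λ _ → sumℕ (map x (allFin (suc (suc n))))) P
    ≈⟨ sym (Ω-sum R x a b c) ⟩
  sumL R (map (wt R a b c) (Ω (suc n) x)) ∎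
  where
  open CommutativeSemiring R using (sym; setoid)
  open import Relation.Binary.Reasoning.Setoid setoid
  x = shiftEnds (suc n) m i j
  P = pathWeight R x a b c 0 0
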